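{- Let $\lambda \ge 2$ be an integer. Then the complete digraph $\overleftrightarrow{K}_{2\lambda+1}$ on $2\lambda+1$ vertices is the only two-way $(\lambda+1,\lambda)$-liking digraph; that is, every two-way $(\lambda+1,\lambda)$-liking digraph is isomorphic to $\overleftrightarrow{K}_{2\lambda+1}$.
   Context: All digraphs are finite, with no loops and no multiple arcs. For positive integers $t$ and $\lambda$, a digraph is a two-way $(t,\lambda)$-liking digraph if every set of $t$ distinct vertices has exactly $\lambda$ common out-neighbors and exactly $\lambda$ common in-neighbors. The complete digraph $\overleftrightarrow{K}_m$ is the digraph on $m$ vertices in which, for every pair $x,y$ of distinct vertices, both arcs $(x,y)$ and $(y,x)$ are present. -}

module Defs where

open import Data.Nat using (ℕ)
open import Data.Bool using (Bool; true; false; not; _∨_)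
open import Data.Fin using (Fin)
open import Data.Fin.Properties using () renaming (_≟_ to _≟ᶠ_)
open import Data.Fin.Subset using (Subset; ∣_∣)
open import Data.Vec using (lookup; tabulate)
open import Data.List using (allFin)
open import Data.Bool.ListAction using (all)
open import Data.Product using (Σ)
open import Function.Bundles using (_⤖_; Bijection)
open import Relation.Nullary.Decidable using (⌊_⌋)
open import Relation.Binary.PropositionalEquality using (_≡_)

record Digraph : Set where
  field
    order    : ℕ
    arc      : Fin order → Fin order → Bool
    loopless : ∀ x → arc x x ≡ false
open Digraph public

module _ (D : Digraph) where
  commonOut : Subset (order D) → Subset (order D)
  commonOut S = tabulate λ v → all (λ s → not (lookup S s) ∨ arc D s v) (allFin (order D))

  commonIn : Subset (order D) → Subset (order D)
  commonIn S = tabulate λ v → all (λ s → not (lookup S s) ∨ arc D v s) (allFin (order D))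

TwoWayLiking : ℕ → ℕ → Digraph → Set
TwoWayLiking t l D =
  (S : Subset (order D)) → ∣ S ∣ ≡ t →
    (∣ commonOut D S ∣ ≡ l) Data.Product.× (∣ commonIn D S ∣ ≡ l)

completeDigraph : ℕ → Digraph
completeDigraph m = record
  { order = m
  ; arc = λ x y → not ⌊ x ≟ᶠ y ⌋
  ; loopless = lem }
  where
  open import Relation.Nullary using (yes; no)
  open import Relation.Binary.PropositionalEquality using (refl)
  open import Data.Empty using (⊥-elim)
  lem : ∀ x → not ⌊ x ≟ᶠ x ⌋ ≡ false
  lem x with x ≟ᶠ x
  ... | yes _ = refl
  ... | no ¬p = ⊥-elim (¬p refl)

_≅_ : Digraph → Digraph → Set
D ≅ E = Σ (Fin (order D) ⤖ Fin (order E)) λ f →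
  ∀ x y → arc D x y ≡ arc E (Bijection.to f x) (Bijection.to f y)

{-# OPTIONS --safe #-}
-- Write l for λ, N⁺ v and N⁻ v for the out- and in-neighbourhood of v, and C⁺ A, C⁻ A for the
-- common out- and in-neighbourhoods of a vertex set A. Adding a vertex v ∉ A to an l-set A
-- gives |C⁺ A ∩ N⁺ v| = l, and hence |C⁺ A| > l; the same holds for C⁻.
--
-- Fix an l-set Q. For p ∉ Q the set C⁺ Q ∩ N⁺ p has l elements, so it determines an
-- equivalence ("twins") on the vertices outside Q; applying the first fact to C⁻ of such a set shows
-- that every twin class contains exactly |Q ∖ N⁻ z| in-neighbours of z, for each z ∈ Q. Double
-- counting then gives |N⁻ x ∖ Q| · |Q ∖ N⁻ y| = |N⁻ y ∖ Q| · |Q ∖ N⁻ x| for x, y ∈ Q. Choosing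
-- Q ⊇ {x, y} inside {x, y} ∪ C⁻ {x, y}, the factors |Q ∖ N⁻ x| and |Q ∖ N⁻ y| are 1 or 2 according
-- to the arcs between x and y. This forces equal in-degrees unless there is a one-way arc, and a
-- one-way arc y → x forces indeg x < indeg y. But then every in-neighbour of y has in-degree at
-- least indeg y, hence points to x, and so does y itself: indeg x > indeg y.
--
-- Now the digraph is a regular graph, and double counting the arcs from ∁ Q to C⁺ Q
-- shows that m = |C⁺ Q| is the same for all l-sets Q. If x ≁ y, take an (l-1)-set P ∋ y avoiding x.
-- For q ∉ P, double counting the arcs between C⁺ P ∖ (P ∪ {q}) and C⁺ (P ∪ {q}) gives
-- (|C⁺ P| - e) l = m (m - e) with e = [q ∈ C⁺ P]; q = x gives e = 0, any q ∈ C⁺ P gives e = 1, and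
-- together they force m = l < m. Finally C⁺ S = ∁ S for any (l+1)-set S, so there are 2l+1 vertices.
module Submission where

open import Defs
open import Data.Nat using (ℕ; zero; suc; _+_; _*_; _∸_; _≤_; _<_; _<?_; z≤n; s≤s; s≤s⁻¹; NonZero; >-nonZero)
open import Data.Nat.Properties
  using ( +-*-semiring; +-commutativeSemigroup; +-identityʳ; +-comm; +-assoc; +-suc; *-suc; *-comm
        ; *-identityʳ; +-cancelˡ-≡; +-cancelʳ-≡; *-cancelʳ-≡; +-cancelʳ-≤; +-mono-≤; +-monoʳ-≤; ≤-refl
        ; ≤-reflexive; ≤-trans; <⇒≤; <-≤-trans; ≤-<-trans; <-irrefl; <-asym; <⇒≢; <⇒≱; m<m+n; n≤1+n
        ; m≤n+m; m+n∸m≡n; m+[n∸m]≡n; ∸-monoˡ-≤; m<n⇒0<n∸m; module ≤-Reasoning)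
open import Data.Bool using (Bool; true; false; not; _∧_; _∨_; if_then_else_)
open import Data.Bool.Properties
  using ( T-≡; not-injective; not-¬; ¬-not; ⇔→≡; ∧-commutativeMonoid; ∨-zeroʳ; ∧-zeroʳ; ∧-comm
        ; ∧-identityʳ; ∧-distribʳ-∨; ∧-conicalˡ; ∧-conicalʳ)
open import Data.Bool.ListAction using (all; and)
open import Data.Fin using (Fin; zero; suc)
open import Data.Fin.Properties using (_≟_)
open import Data.Fin.Subset using (Subset; ∣_∣)
open import Data.Vec using (tabulate)
open import Data.Vec.Properties using (tabulate-cong; lookup∘tabulate)
open import Data.Vec.Functional using (_∷_)
open import Data.List using (allFin)
open import Data.List.Properties using (map-cong)
open import Data.List.Relation.Unary.All.Properties using (all⁺; all⁻; tabulate⁺; tabulate⁻)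
open import Data.Product using (Σ-syntax; ∃-syntax; _×_; _,_; proj₁; proj₂)
open import Data.Sum using (_⊎_; inj₁; inj₂)
open import Data.Empty using (⊥; ⊥-elim)
open import Function using (_∘_; flip; Equivalence; mk⇔)
open import Function.Construct.Identity using (⤖-id)
open import Relation.Nullary using (Dec; yes; no; does; contradiction)
open import Relation.Nullary.Decidable using (⌊_⌋; dec-true; dec-false)
open import Relation.Binary.PropositionalEquality
open import Algebra.Bundles using (CommutativeMonoid)
open import Algebra.Properties.Semiring.Sum +-*-semiring
  using (sum-syntax; sum-cong-≗; ∑-comm; ∑-distrib-+; *-distribʳ-sum; sum-replicate-zero)
import Algebra.Properties.CommutativeSemigroup as CommutativeSemigroupProperties

module ∧-Props = CommutativeSemigroupProperties (CommutativeMonoid.commutativeSemigroup ∧-commutativeMonoid)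
module +-Props = CommutativeSemigroupProperties +-commutativeSemigroup

∧-intro : ∀ {a b} → a ≡ true → b ≡ true → a ∧ b ≡ true
∧-intro refl refl = refl

∨-introˡ : ∀ {a} b → a ≡ true → a ∨ b ≡ true
∨-introˡ b refl = refl

∨-introʳ : ∀ a {b} → b ≡ true → a ∨ b ≡ true
∨-introʳ a refl = ∨-zeroʳ a

∨-elim : ∀ a {b} → a ∨ b ≡ true → a ≡ true ⊎ b ≡ true
∨-elim true  _ = inj₁ refl
∨-elim false p = inj₂ p

implies-intro : ∀ {a b} → (a ≡ true → b ≡ true) → not a ∨ b ≡ true
implies-intro {true}  a⇒b = a⇒b refl
implies-intro {false} _   = refl

implies-elim : ∀ {a b} → not a ∨ b ≡ true → a ≡ true → b ≡ true
implies-elim a⇒b refl = a⇒b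

does⇒ : ∀ {A : Set} (a? : Dec A) → does a? ≡ true → A
does⇒ (yes a) _ = a

all-allFin⁺ : ∀ {n} (p : Fin n → Bool) → (∀ i → p i ≡ true) → all p (allFin n) ≡ true
all-allFin⁺ p p≡true = Equivalence.to T-≡ (all⁻ p (tabulate⁺ (Equivalence.from T-≡ ∘ p≡true)))

all-allFin⁻ : ∀ {n} (p : Fin n → Bool) → all p (allFin n) ≡ true → ∀ i → p i ≡ true
all-allFin⁻ {n} p all≡true i =
  Equivalence.to T-≡ (tabulate⁻ (all⁺ p (allFin n) (Equivalence.from T-≡ all≡true)) i)

-- Vertex sets are Boolean predicates, so that a cardinality is a sum and double counting is ∑-comm.
Pred : ℕ → Set
Pred n = Fin n → Bool

module _ {n : ℕ} where

  infix  4 _∈_ _∉_ _⊆_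
  infixr 7 _∩_
  infixr 6 _∪_

  _∈_ : Fin n → Pred n → Set
  x ∈ P = P x ≡ true

  _∉_ : Fin n → Pred n → Set
  x ∉ P = P x ≡ false

  _⊆_ : Pred n → Pred n → Set
  P ⊆ Q = ∀ x → x ∈ P → x ∈ Q

  ∅ : Pred n
  ∅ _ = false

  ⁅_⁆ : Fin n → Pred n
  ⁅ y ⁆ x = does (x ≟ y)

  ∁ : Pred n → Pred n
  ∁ P x = not (P x)

  _∩_ : Pred n → Pred n → Pred n
  (P ∩ Q) x = P x ∧ Q x

  _∪_ : Pred n → Pred n → Pred n
  (P ∪ Q) x = P x ∨ Q x

  ∈⊎∉ : ∀ P x → x ∈ P ⊎ x ∉ P
  ∈⊎∉ P x with P x
  ... | true  = inj₁ refl
  ... | false = inj₂ refl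

  ⊆-antisym : ∀ {P Q} → P ⊆ Q → Q ⊆ P → P ≗ Q
  ⊆-antisym P⊆Q Q⊆P x = ⇔→≡ (mk⇔ (P⊆Q x) (Q⊆P x))

  P∩Q⊆P : ∀ P Q → P ∩ Q ⊆ P
  P∩Q⊆P P Q x = ∧-conicalˡ (P x) (Q x)

  P∩Q⊆Q : ∀ P Q → P ∩ Q ⊆ Q
  P∩Q⊆Q P Q x = ∧-conicalʳ (P x) (Q x)

  x∈⁅x⁆ : ∀ x → x ∈ ⁅ x ⁆
  x∈⁅x⁆ x = dec-true (x ≟ x) refl

  x∈⁅y⁆⇒x≡y : ∀ {x y} → x ∈ ⁅ y ⁆ → x ≡ y
  x∈⁅y⁆⇒x≡y {x} {y} = does⇒ (x ≟ y)

  x≢y⇒x∉⁅y⁆ : ∀ {x y} → x ≢ y → x ∉ ⁅ y ⁆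
  x≢y⇒x∉⁅y⁆ {x} {y} = dec-false (x ≟ y)

χ : Bool → ℕ
χ b = if b then 1 else 0

-- Opaque, so that unification never unfolds a cardinality into a sum.
opaque

  count : ∀ {n} → Pred n → ℕ
  count {n} P = ∑[ i < n ] χ (P i)

  count-cong : ∀ {n} {P Q : Pred n} → P ≗ Q → count P ≡ count Q
  count-cong P≗Q = sum-cong-≗ (cong χ ∘ P≗Q)

  count-∅ : ∀ {n} → count (∅ {n}) ≡ 0
  count-∅ {n} = sum-replicate-zero n

  count-∩-∁ : ∀ {n} (P Q : Pred n) → count P ≡ count (P ∩ Q) + count (P ∩ ∁ Q)
  count-∩-∁ P Q = trans (sum-cong-≗ split) (∑-distrib-+ (χ ∘ (P ∩ Q)) (χ ∘ (P ∩ ∁ Q)))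
    where
    split : ∀ x → χ (P x) ≡ χ (P x ∧ Q x) + χ (P x ∧ not (Q x))
    split x with P x | Q x
    ... | true  | true  = refl
    ... | true  | false = refl
    ... | false | _     = refl

  count-∪ : ∀ {n} (P Q : Pred n) → (∀ x → x ∈ P → x ∉ Q) → count (P ∪ Q) ≡ count P + count Q
  count-∪ P Q disjoint = trans (sum-cong-≗ split) (∑-distrib-+ (χ ∘ P) (χ ∘ Q))
    where
    split : ∀ x → χ (P x ∨ Q x) ≡ χ (P x) + χ (Q x)
    split x with P x in Px | Q x in Qx
    ... | true  | true  = contradiction (disjoint x Px) (not-¬ Qx)
    ... | true  | false = refl
    ... | false | _     = refl

  count-∁ : ∀ {n} (P : Pred n) → count P + count (∁ P) ≡ n
  count-∁ {zero}  P = refl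
  count-∁ {suc n} P with P zero | count-∁ (λ i → P (suc i))
  ... | true  | eq = cong suc eq
  ... | false | eq = trans (+-suc _ _) (cong suc eq)

  count-⁅⁆-∩ : ∀ {n} (y : Fin n) (P : Pred n) → count (⁅ y ⁆ ∩ P) ≡ χ (P y)
  count-⁅⁆-∩ {suc n} zero    P = trans (cong (χ (P zero) +_) (count-∅ {n})) (+-identityʳ _)
  count-⁅⁆-∩ {suc n} (suc y) P = count-⁅⁆-∩ y (λ i → P (suc i))

  count-mono : ∀ {n} {P Q : Pred n} → P ⊆ Q → count P ≤ count Q
  count-mono {zero}  P⊆Q = z≤n
  count-mono {suc n} {P} {Q} P⊆Q = +-mono-≤ head≤ (count-mono (λ x → P⊆Q (suc x)))
    where
    head≤ : χ (P zero) ≤ χ (Q zero)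
    head≤ with P zero in P₀ | Q zero in Q₀
    ... | true  | true  = ≤-refl
    ... | true  | false = contradiction Q₀ (not-¬ (P⊆Q zero P₀))
    ... | false | _     = z≤n

  1≤count⇒∃ : ∀ {n} (P : Pred n) → 1 ≤ count P → ∃[ x ] x ∈ P
  1≤count⇒∃ {suc n} P 1≤P with P zero in P₀
  ... | true  = zero , P₀
  ... | false = let x , x∈P = 1≤count⇒∃ (λ i → P (suc i)) 1≤P in suc x , x∈P

  choose : ∀ {n} (P : Pred n) {k} → k ≤ count P → Σ[ R ∈ Pred n ] R ⊆ P × count R ≡ k
  choose {n} P {zero} _ = ∅ , (λ _ ()) , count-∅ {n}
  choose {suc n} P {suc k} k<P with P zero in P₀
  ... | true  = let R , R⊆P , |R| = choose (λ i → P (suc i)) (s≤s⁻¹ k<P)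
                in  (true ∷ R) , (λ { zero _ → P₀ ; (suc i) r → R⊆P i r }) , cong suc |R|
  ... | false = let R , R⊆P , |R| = choose (λ i → P (suc i)) k<P
                in  (false ∷ R) , (λ { zero () ; (suc i) r → R⊆P i r }) , |R|

  double-count : ∀ {m n} {A : Pred m} {B : Pred n} (E : Fin m → Fin n → Bool) {α β} →
                 (∀ a → a ∈ A → count (λ b → B b ∧ E a b) ≡ α) →
                 (∀ b → b ∈ B → count (λ a → A a ∧ E a b) ≡ β) →
                 count A * α ≡ count B * β
  double-count {m} {n} {A} {B} E {α} {β} rows cols = begin
    count A * α                                       ≡⟨ ∑χ*≡count* A rows ⟨
    ∑[ a < m ] (χ (A a) * count (λ b → B b ∧ E a b))  ≡⟨ sum-cong-≗ (λ a → χ*count (A a) (λ b → B b ∧ E a b)) ⟩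
    ∑[ a < m ] ∑[ b < n ] χ (A a ∧ (B b ∧ E a b))     ≡⟨ ∑-comm (λ a b → χ (A a ∧ (B b ∧ E a b))) ⟩
    ∑[ b < n ] ∑[ a < m ] χ (A a ∧ (B b ∧ E a b))     ≡⟨ sum-cong-≗ (λ b → sum-cong-≗ (λ a → cong χ (swap a b))) ⟩
    ∑[ b < n ] ∑[ a < m ] χ (B b ∧ (A a ∧ E a b))     ≡⟨ sum-cong-≗ (λ b → χ*count (B b) (λ a → A a ∧ E a b)) ⟨
    ∑[ b < n ] (χ (B b) * count (λ a → A a ∧ E a b))  ≡⟨ ∑χ*≡count* B cols ⟩
    count B * β                                       ∎
    where
    open ≡-Reasoning
    swap : ∀ a b → A a ∧ (B b ∧ E a b) ≡ B b ∧ (A a ∧ E a b)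
    swap a b = ∧-Props.x∙yz≈y∙xz (A a) (B b) (E a b)
    ∑χ*≡count* : ∀ {k} (P : Pred k) {f : Fin k → ℕ} {c} → (∀ x → x ∈ P → f x ≡ c) →
                 ∑[ x < k ] (χ (P x) * f x) ≡ count P * c
    ∑χ*≡count* P {f} {c} f≡c = trans (sum-cong-≗ pointwise) (sym (*-distribʳ-sum c (χ ∘ P)))
      where
      pointwise : ∀ x → χ (P x) * f x ≡ χ (P x) * c
      pointwise x with P x in Px
      ... | true  = cong (_+ 0) (f≡c x Px)
      ... | false = refl
    χ*count : ∀ {k} b (P : Pred k) → χ b * count P ≡ count (λ x → b ∧ P x)
    χ*count     true  P = +-identityʳ (count P)
    χ*count {k} false P = sym (count-∅ {k})

  ∣tabulate∣≡count : ∀ {n} (P : Pred n) → ∣ tabulate P ∣ ≡ count P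
  ∣tabulate∣≡count {zero}  P = refl
  ∣tabulate∣≡count {suc n} P with P zero
  ... | true  = cong suc (∣tabulate∣≡count (λ i → P (suc i)))
  ... | false = ∣tabulate∣≡count (λ i → P (suc i))

count-∁∅ : ∀ {n} → count (∁ (∅ {n})) ≡ n
count-∁∅ {n} = trans (cong (_+ count (∁ (∅ {n}))) (sym (count-∅ {n}))) (count-∁ (∅ {n}))

count-∁-∸ : ∀ {n} (P : Pred n) → count (∁ P) ≡ n ∸ count P
count-∁-∸ P = trans (sym (m+n∸m≡n (count P) (count (∁ P)))) (cong (_∸ count P) (count-∁ P))

count-∩-comm : ∀ {n} (P Q : Pred n) → count (P ∩ Q) ≡ count (Q ∩ P)
count-∩-comm P Q = count-cong (λ x → ∧-comm (P x) (Q x))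

count-⁅⁆ : ∀ {n} (y : Fin n) → count ⁅ y ⁆ ≡ 1
count-⁅⁆ y = trans (count-cong (λ x → sym (∧-identityʳ (⁅ y ⁆ x)))) (count-⁅⁆-∩ y (λ _ → true))

count-∪-⁅⁆ : ∀ {n} {A : Pred n} {y} → y ∉ A → count (A ∪ ⁅ y ⁆) ≡ suc (count A)
count-∪-⁅⁆ {A = A} {y} y∉A = begin
  count (A ∪ ⁅ y ⁆)      ≡⟨ count-∪ A ⁅ y ⁆ A∩⁅y⁆≡∅ ⟩
  count A + count ⁅ y ⁆  ≡⟨ cong (count A +_) (count-⁅⁆ y) ⟩
  count A + 1            ≡⟨ +-comm (count A) 1 ⟩
  suc (count A)          ∎
  where
  open ≡-Reasoning
  A∩⁅y⁆≡∅ : ∀ x → x ∈ A → x ∉ ⁅ y ⁆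
  A∩⁅y⁆≡∅ x x∈A = x≢y⇒x∉⁅y⁆ {x = x} (λ { refl → not-¬ x∈A y∉A })

count-⁅⁆∪⁅⁆-∩ : ∀ {n} {x y : Fin n} → x ≢ y → (P : Pred n) →
                count ((⁅ x ⁆ ∪ ⁅ y ⁆) ∩ P) ≡ χ (P x) + χ (P y)
count-⁅⁆∪⁅⁆-∩ {x = x} {y} x≢y P = begin
  count ((⁅ x ⁆ ∪ ⁅ y ⁆) ∩ P)            ≡⟨ count-cong (λ v → ∧-distribʳ-∨ (P v) (⁅ x ⁆ v) (⁅ y ⁆ v)) ⟩
  count ((⁅ x ⁆ ∩ P) ∪ (⁅ y ⁆ ∩ P))      ≡⟨ count-∪ (⁅ x ⁆ ∩ P) (⁅ y ⁆ ∩ P) disjoint ⟩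
  count (⁅ x ⁆ ∩ P) + count (⁅ y ⁆ ∩ P)  ≡⟨ cong₂ _+_ (count-⁅⁆-∩ x P) (count-⁅⁆-∩ y P) ⟩
  χ (P x) + χ (P y)                      ∎
  where
  open ≡-Reasoning
  disjoint : ∀ v → v ∈ ⁅ x ⁆ ∩ P → v ∉ ⁅ y ⁆ ∩ P
  disjoint v v∈ with x∈⁅y⁆⇒x≡y {x = v} (P∩Q⊆P ⁅ x ⁆ P v v∈)
  ... | refl = cong (_∧ P v) (x≢y⇒x∉⁅y⁆ x≢y)

∈⇒1≤count : ∀ {n} (P : Pred n) {x} → x ∈ P → 1 ≤ count P
∈⇒1≤count P {x} x∈P = begin
  1                  ≡⟨ cong χ x∈P ⟨
  χ (P x)            ≡⟨ count-⁅⁆-∩ x P ⟨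
  count (⁅ x ⁆ ∩ P)  ≤⟨ count-mono (P∩Q⊆Q ⁅ x ⁆ P) ⟩
  count P            ∎
  where open ≤-Reasoning

count-⊆ : ∀ {n} {P Q : Pred n} → P ⊆ Q → count Q ≡ count P + count (Q ∩ ∁ P)
count-⊆ {P = P} {Q} P⊆Q = trans (count-∩-∁ Q P) (cong (_+ count (Q ∩ ∁ P)) (count-cong Q∩P≗P))
  where
  Q∩P≗P : Q ∩ P ≗ P
  Q∩P≗P = ⊆-antisym (P∩Q⊆Q Q P) (λ x x∈P → ∧-intro (P⊆Q x x∈P) x∈P)

count-< : ∀ {n} {P Q : Pred n} {x} → P ⊆ Q → x ∉ P → x ∈ Q → count P < count Q
count-< {P = P} {Q} P⊆Q x∉P x∈Q = begin-strict
  count P                    <⟨ m<m+n (count P) (∈⇒1≤count (Q ∩ ∁ P) (∧-intro x∈Q (cong not x∉P))) ⟩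
  count P + count (Q ∩ ∁ P)  ≡⟨ count-⊆ P⊆Q ⟨
  count Q                    ∎
  where open ≤-Reasoning

count-≤⇒⊇ : ∀ {n} {P Q : Pred n} → P ⊆ Q → count Q ≤ count P → Q ⊆ P
count-≤⇒⊇ {P = P} P⊆Q Q≤P x x∈Q with ∈⊎∉ P x
... | inj₁ x∈P = x∈P
... | inj₂ x∉P = contradiction Q≤P (<⇒≱ (count-< P⊆Q x∉P x∈Q))

count-─ : ∀ {n} {A B : Pred n} → A ⊆ B → count (B ∩ ∁ A) ≡ count B ∸ count A
count-─ {A = A} {B} A⊆B =
  trans (sym (m+n∸m≡n (count A) (count (B ∩ ∁ A)))) (cong (_∸ count A) (sym (count-⊆ A⊆B)))

extend : ∀ {n} {A B : Pred n} {k} → A ⊆ B → count A ≤ k → k ≤ count B →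
         Σ[ C ∈ Pred n ] A ⊆ C × C ⊆ B × count C ≡ k
extend {A = A} {B} {k} A⊆B A≤k k≤B
  with choose (B ∩ ∁ A) (subst (k ∸ count A ≤_) (sym (count-─ A⊆B)) (∸-monoˡ-≤ (count A) k≤B))
... | R , R⊆B∖A , |R| = A ∪ R , (λ x → ∨-introˡ (R x)) , A∪R⊆B , |A∪R|
  where
  A∪R⊆B : A ∪ R ⊆ B
  A∪R⊆B x x∈A∪R with ∨-elim (A x) x∈A∪R
  ... | inj₁ x∈A = A⊆B x x∈A
  ... | inj₂ x∈R = P∩Q⊆P B (∁ A) x (R⊆B∖A x x∈R)
  A∩R≡∅ : ∀ x → x ∈ A → x ∉ R
  A∩R≡∅ x x∈A = ¬-not λ x∈R → not-¬ x∈A (not-injective (P∩Q⊆Q B (∁ A) x (R⊆B∖A x x∈R)))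
  |A∪R| : count (A ∪ R) ≡ k
  |A∪R| = begin
    count (A ∪ R)            ≡⟨ count-∪ A R A∩R≡∅ ⟩
    count A + count R        ≡⟨ cong (count A +_) |R| ⟩
    count A + (k ∸ count A)  ≡⟨ m+[n∸m]≡n A≤k ⟩
    k                        ∎
    where open ≡-Reasoning

module Neighbourhood {n : ℕ} (r : Fin n → Fin n → Bool) where

  N : Fin n → Pred n
  N = r

  indegree : Fin n → ℕ
  indegree v = count (λ u → r u v)

  common : Pred n → Pred n
  common A v = all (λ s → not (A s) ∨ r s v) (allFin n)

  ∈-common⁺ : ∀ {A v} → (∀ s → s ∈ A → r s v ≡ true) → v ∈ common A
  ∈-common⁺ A⇒r = all-allFin⁺ _ (λ s → implies-intro (A⇒r s))

  ∈-common⁻ : ∀ {A v} → v ∈ common A → ∀ s → s ∈ A → r s v ≡ true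
  ∈-common⁻ v∈ s = implies-elim (all-allFin⁻ _ v∈ s)

  common-antitone : ∀ {A B} → A ⊆ B → common B ⊆ common A
  common-antitone A⊆B v v∈ = ∈-common⁺ (λ s s∈A → ∈-common⁻ v∈ s (A⊆B s s∈A))

  common-∪-⁅⁆ : ∀ A v → common (A ∪ ⁅ v ⁆) ≗ common A ∩ N v
  common-∪-⁅⁆ A v = ⊆-antisym forth back
    where
    forth : common (A ∪ ⁅ v ⁆) ⊆ common A ∩ N v
    forth u u∈ = ∧-intro (common-antitone (λ s → ∨-introˡ (⁅ v ⁆ s)) u u∈)
                         (∈-common⁻ u∈ v (∨-introʳ (A v) (x∈⁅x⁆ v)))
    back : common A ∩ N v ⊆ common (A ∪ ⁅ v ⁆)
    back u u∈ = ∈-common⁺ r-from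
      where
      r-from : ∀ s → s ∈ A ∪ ⁅ v ⁆ → r s u ≡ true
      r-from s s∈ with ∨-elim (A s) s∈
      ... | inj₁ s∈A = ∈-common⁻ (P∩Q⊆P (common A) (N v) u u∈) s s∈A
      ... | inj₂ s≡v = subst (λ t → r t u ≡ true) (sym (x∈⁅y⁆⇒x≡y s≡v)) (P∩Q⊆Q (common A) (N v) u u∈)

module Liking {n : ℕ} (r : Fin n → Fin n → Bool) (irreflexive : ∀ x → r x x ≡ false)
              (l : ℕ) (l<n : l < n)
              (liking : ∀ A → count A ≡ suc l → count (Neighbourhood.common r A) ≡ l) where

  open Neighbourhood r public

  common-disjoint : ∀ {A v} → v ∈ common A → v ∉ A
  common-disjoint {A} {v} v∈ = ¬-not λ v∈A → not-¬ (∈-common⁻ v∈ v v∈A) (irreflexive v)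

  count-common-∩-N : ∀ {A v} → count A ≡ l → v ∉ A → count (common A ∩ N v) ≡ l
  count-common-∩-N {A} {v} |A| v∉A = begin
    count (common A ∩ N v)      ≡⟨ count-cong (common-∪-⁅⁆ A v) ⟨
    count (common (A ∪ ⁅ v ⁆))  ≡⟨ liking (A ∪ ⁅ v ⁆) |A∪⁅v⁆| ⟩
    l                           ∎
    where
    open ≡-Reasoning
    |A∪⁅v⁆| : count (A ∪ ⁅ v ⁆) ≡ suc l
    |A∪⁅v⁆| = trans (count-∪-⁅⁆ {A = A} v∉A) (cong suc |A|)

  l≤count-common : ∀ {A} → count A ≤ suc l → l ≤ count (common A)
  l≤count-common {A} A≤ with extend {B = ∁ ∅} (λ _ _ → refl) A≤ (subst (suc l ≤_) (sym count-∁∅) l<n)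
  ... | B , A⊆B , _ , |B| = subst (_≤ count (common A)) (liking B |B|) (count-mono (common-antitone A⊆B))

  l<count-common : 0 < l → ∀ {A} → count A ≡ l → l < count (common A)
  l<count-common 0<l {A} |A|
    with 1≤count⇒∃ (∁ A) (subst (1 ≤_) (sym (trans (count-∁-∸ A) (cong (n ∸_) |A|))) (m<n⇒0<n∸m l<n))
  ... | v , v∈∁A
    with 1≤count⇒∃ (common A ∩ N v) (subst (1 ≤_) (sym (count-common-∩-N |A| (not-injective v∈∁A))) 0<l)
  ... | u , u∈ = begin-strict
    l                       ≡⟨ count-common-∩-N |A| (common-disjoint u∈C) ⟨
    count (common A ∩ N u)  <⟨ count-< (P∩Q⊆P (common A) (N u)) u∉C∩Nu u∈C ⟩
    count (common A)        ∎
    where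
    open ≤-Reasoning
    u∈C : u ∈ common A
    u∈C = P∩Q⊆P (common A) (N v) u u∈
    u∉C∩Nu : u ∉ common A ∩ N u
    u∉C∩Nu = trans (cong (common A u ∧_) (irreflexive u)) (∧-zeroʳ (common A u))

module _ {n : ℕ} (r : Fin n → Fin n → Bool) (irreflexive : ∀ x → r x x ≡ false) where

  open Neighbourhood r using (indegree)

  no-one-way-arc⇒symmetric : (∀ x y → r y x ≡ true → r x y ≡ false → ⊥) → ∀ x y → r x y ≡ r y x
  no-one-way-arc⇒symmetric no-one-way x y with r x y in xy | r y x in yx
  ... | true  | true  = refl
  ... | false | false = refl
  ... | true  | false = ⊥-elim (no-one-way y x xy yx)
  ... | false | true  = ⊥-elim (no-one-way x y yx xy)

  one-way-arcs-descend⇒symmetric :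
    (∀ x y → x ≢ y → r x y ≡ r y x → indegree x ≡ indegree y) →
    (∀ x y → r y x ≡ true → r x y ≡ false → indegree x < indegree y) →
    ∀ x y → r x y ≡ r y x
  one-way-arcs-descend⇒symmetric balanced descend = no-one-way-arc⇒symmetric no-one-way-arc
    where
    no-one-way-arc : ∀ x y → r y x ≡ true → r x y ≡ false → ⊥
    no-one-way-arc x y yx xy = <-asym dx<dy dy<dx
      where
      dx<dy : indegree x < indegree y
      dx<dy = descend x y yx xy
      H : Pred n
      H z = does (indegree x <? indegree z)
      H⊆N⁻x : H ⊆ (λ z → r z x)
      H⊆N⁻x z z∈H with r z x in zx | r x z in xz
      ... | true  | _     = refl
      ... | false | false = contradiction (balanced z x z≢x (trans zx (sym xz))) (<⇒≢ dx<dz ∘ sym)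
        where
        dx<dz : indegree x < indegree z
        dx<dz = does⇒ (indegree x <? indegree z) z∈H
        z≢x : z ≢ x
        z≢x refl = <-irrefl refl dx<dz
      ... | false | true  = contradiction (does⇒ (indegree x <? indegree z) z∈H) (<-asym (descend z x xz zx))
      N⁻y⊆H∖y : (λ z → r z y) ⊆ H ∩ ∁ ⁅ y ⁆
      N⁻y⊆H∖y z zy = ∧-intro (dec-true (indegree x <? indegree z) (<-≤-trans dx<dy dy≤dz))
                             (cong not (x≢y⇒x∉⁅y⁆ z≢y))
        where
        z≢y : z ≢ y
        z≢y refl = not-¬ zy (irreflexive z)
        dy≤dz : indegree y ≤ indegree z
        dy≤dz with r y z in yz
        ... | true  = ≤-reflexive (balanced y z (z≢y ∘ sym) (trans yz (sym zy)))
        ... | false = <⇒≤ (descend y z zy yz)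
      dy<dx : indegree y < indegree x
      dy<dx = begin-strict
        indegree y           ≤⟨ count-mono N⁻y⊆H∖y ⟩
        count (H ∩ ∁ ⁅ y ⁆)  <⟨ count-< (P∩Q⊆P H (∁ ⁅ y ⁆)) y∉H∖y (dec-true (indegree x <? indegree y) dx<dy) ⟩
        count H              ≤⟨ count-mono H⊆N⁻x ⟩
        indegree x           ∎
        where
        open ≤-Reasoning
        y∉H∖y : y ∉ H ∩ ∁ ⁅ y ⁆
        y∉H∖y = trans (cong (λ b → H y ∧ not b) (x∈⁅x⁆ y)) (∧-zeroʳ (H y))

private
  equal-balance : ∀ {a b c dx dy m} .{{_ : NonZero c}} →
                  a * c ≡ b * c → dx + c ≡ m + a → dy + c ≡ m + b → dx ≡ dy
  equal-balance {a} {b} {c} {dx} {dy} {m} ac≡bc x y =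
    +-cancelʳ-≡ c dx dy (trans x (trans (cong (m +_) (*-cancelʳ-≡ a b c ac≡bc)) (sym y)))

  one-way-balance : ∀ {a b dx dy m} →
                    a * 2 ≡ b * 1 → dx + 1 ≡ m + a → dy + 2 ≡ m + b → 1 < a → dx < dy
  one-way-balance {a} {b} {dx} {dy} {m} a2≡b x y 1<a = +-cancelʳ-≤ 2 (suc dx) dy (begin
    suc dx + 2   ≡⟨ cong (_+ 2) (+-comm 1 dx) ⟩
    dx + 1 + 2   ≤⟨ +-monoʳ-≤ (dx + 1) 1<a ⟩
    dx + 1 + a   ≡⟨ cong (_+ a) x ⟩
    m + a + a    ≡⟨ +-assoc m a a ⟩
    m + (a + a)  ≡⟨ cong (m +_) a+a≡b ⟩
    m + b        ≡⟨ y ⟨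
    dy + 2       ∎)
    where
    open ≤-Reasoning
    a+a≡b : a + a ≡ b
    a+a≡b = trans (cong (a +_) (sym (+-identityʳ a))) (trans (*-comm 2 a) (trans a2≡b (*-identityʳ b)))

  shifted-identities⇒≡ : ∀ {c l m} → 0 < c → 0 < m →
                         c * l ≡ m * m → (c ∸ 1) * l ≡ m * (m ∸ 1) → m ≡ l
  shifted-identities⇒≡ {suc c} {l} {suc m} _ _ e₀ e₁ = +-cancelʳ-≡ (c * l) (suc m) l (begin
    suc m + c * l      ≡⟨ cong (suc m +_) e₁ ⟩
    suc m + suc m * m  ≡⟨ *-suc (suc m) m ⟨
    suc m * suc m      ≡⟨ e₀ ⟨
    l + c * l          ∎)
    where open ≡-Reasoning

module TwoWayLikingDigraph {n : ℕ} (arc : Fin n → Fin n → Bool) (loopless : ∀ x → arc x x ≡ false)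
  (k : ℕ) (l<n : 2 + k < n)
  (out-liking : ∀ A → count A ≡ 3 + k → count (Neighbourhood.common arc A) ≡ 2 + k)
  (in-liking  : ∀ A → count A ≡ 3 + k → count (Neighbourhood.common (flip arc) A) ≡ 2 + k) where

  l : ℕ
  l = 2 + k

  module Out = Liking arc loopless l l<n out-liking
  module In  = Liking (flip arc) loopless l l<n in-liking
  open Out using (indegree) renaming (N to N⁺; common to C⁺)
  open In  using () renaming (N to N⁻; common to C⁻)

  indegree-split : ∀ Q x → indegree x + count (Q ∩ ∁ (N⁻ x)) ≡ count Q + count (∁ Q ∩ N⁻ x)
  indegree-split Q x = begin
    indegree x + q̄                  ≡⟨ cong (_+ q̄) N⁻x-split ⟩
    count (Q ∩ N⁻ x) + q̄′ + q̄       ≡⟨ +-Props.xy∙z≈xz∙y (count (Q ∩ N⁻ x)) q̄′ q̄ ⟩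
    count (Q ∩ N⁻ x) + q̄ + q̄′       ≡⟨ cong (_+ q̄′) (count-∩-∁ Q (N⁻ x)) ⟨
    count Q + q̄′                    ∎
    where
    open ≡-Reasoning
    q̄ q̄′ : ℕ
    q̄  = count (Q ∩ ∁ (N⁻ x))
    q̄′ = count (∁ Q ∩ N⁻ x)
    N⁻x-split : indegree x ≡ count (Q ∩ N⁻ x) + q̄′
    N⁻x-split = trans (count-∩-∁ (N⁻ x) Q) (cong₂ _+_ (count-∩-comm (N⁻ x) Q) (count-∩-comm (N⁻ x) (∁ Q)))

  module Twins {Q : Pred n} (|Q| : count Q ≡ l) where

    -- For p, q ∉ Q the sets C⁺ Q ∩ N⁺ p and C⁺ Q ∩ N⁺ q both have l elements, which makes twin
    -- symmetric there.
    twin : Fin n → Fin n → Bool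
    twin p = C⁻ (C⁺ Q ∩ N⁺ p)

    twin-sym : ∀ {p q} → p ∉ Q → q ∉ Q → twin p q ≡ true → twin q p ≡ true
    twin-sym {p} {q} p∉Q q∉Q pq = In.∈-common⁺ (λ s s∈ → P∩Q⊆Q (C⁺ Q) (N⁺ p) s (Xq⊆Xp s s∈))
      where
      Xp⊆Xq : C⁺ Q ∩ N⁺ p ⊆ C⁺ Q ∩ N⁺ q
      Xp⊆Xq s s∈ = ∧-intro (P∩Q⊆P (C⁺ Q) (N⁺ p) s s∈) (In.∈-common⁻ pq s s∈)
      |Xq|≤|Xp| : count (C⁺ Q ∩ N⁺ q) ≤ count (C⁺ Q ∩ N⁺ p)
      |Xq|≤|Xp| = ≤-reflexive (trans (Out.count-common-∩-N |Q| q∉Q) (sym (Out.count-common-∩-N |Q| p∉Q)))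
      Xq⊆Xp : C⁺ Q ∩ N⁺ q ⊆ C⁺ Q ∩ N⁺ p
      Xq⊆Xp = count-≤⇒⊇ Xp⊆Xq |Xq|≤|Xp|

    twin-comm : ∀ {p q} → p ∉ Q → q ∉ Q → twin p q ≡ twin q p
    twin-comm p∉Q q∉Q = ⇔→≡ (mk⇔ (twin-sym p∉Q q∉Q) (twin-sym q∉Q p∉Q))

    twin-in-neighbours : ∀ {z p} → z ∈ Q → p ∉ Q →
                         count (λ q → (∁ Q ∩ N⁻ z) q ∧ twin p q) ≡ count (Q ∩ ∁ (N⁻ z))
    twin-in-neighbours {z} {p} z∈Q p∉Q = +-cancelˡ-≡ (count (Q ∩ N⁻ z)) _ _ (begin
      count (Q ∩ N⁻ z) + count (λ q → (∁ Q ∩ N⁻ z) q ∧ twin p q)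
        ≡⟨ cong₂ _+_ (count-cong inside) (count-cong outside) ⟩
      count ((C⁻ X ∩ N⁻ z) ∩ Q) + count ((C⁻ X ∩ N⁻ z) ∩ ∁ Q)
        ≡⟨ count-∩-∁ (C⁻ X ∩ N⁻ z) Q ⟨
      count (C⁻ X ∩ N⁻ z)
        ≡⟨ In.count-common-∩-N (Out.count-common-∩-N |Q| p∉Q) z∉X ⟩
      l
        ≡⟨ trans (sym |Q|) (count-∩-∁ Q (N⁻ z)) ⟩
      count (Q ∩ N⁻ z) + count (Q ∩ ∁ (N⁻ z))
        ∎)
      where
      open ≡-Reasoning
      X : Pred n
      X = C⁺ Q ∩ N⁺ p
      z∉X : z ∉ X
      z∉X = cong (_∧ arc p z) (¬-not λ z∈C⁺Q → not-¬ z∈Q (Out.common-disjoint z∈C⁺Q))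
      Q⊆C⁻X : Q ⊆ C⁻ X
      Q⊆C⁻X s s∈Q = In.∈-common⁺ (λ t t∈X → Out.∈-common⁻ (P∩Q⊆P (C⁺ Q) (N⁺ p) t t∈X) s s∈Q)
      inside : Q ∩ N⁻ z ≗ (C⁻ X ∩ N⁻ z) ∩ Q
      inside = ⊆-antisym {P = Q ∩ N⁻ z} forth back
        where
        forth : Q ∩ N⁻ z ⊆ (C⁻ X ∩ N⁻ z) ∩ Q
        forth q q∈ = let q∈Q = P∩Q⊆P Q (N⁻ z) q q∈ in
                     ∧-intro (∧-intro (Q⊆C⁻X q q∈Q) (P∩Q⊆Q Q (N⁻ z) q q∈)) q∈Q
        back : (C⁻ X ∩ N⁻ z) ∩ Q ⊆ Q ∩ N⁻ z
        back q q∈ = ∧-intro (P∩Q⊆Q (C⁻ X ∩ N⁻ z) Q q q∈) (P∩Q⊆Q (C⁻ X) (N⁻ z) q (P∩Q⊆P (C⁻ X ∩ N⁻ z) Q q q∈))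
      outside : ∀ q → (not (Q q) ∧ arc q z) ∧ twin p q ≡ (C⁻ X q ∧ arc q z) ∧ not (Q q)
      outside q = ∧-Props.xy∙z≈zy∙x (not (Q q)) (arc q z) (C⁻ X q)

    in-balance : ∀ {x y} → x ∈ Q → y ∈ Q →
      count (∁ Q ∩ N⁻ x) * count (Q ∩ ∁ (N⁻ y)) ≡ count (∁ Q ∩ N⁻ y) * count (Q ∩ ∁ (N⁻ x))
    in-balance {x} {y} x∈Q y∈Q = double-count twin rows cols
      where
      rows : ∀ p → p ∈ ∁ Q ∩ N⁻ x → count (λ q → (∁ Q ∩ N⁻ y) q ∧ twin p q) ≡ count (Q ∩ ∁ (N⁻ y))
      rows p p∈ = twin-in-neighbours y∈Q (not-injective (P∩Q⊆P (∁ Q) (N⁻ x) p p∈))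
      cols : ∀ q → q ∈ ∁ Q ∩ N⁻ y → count (λ p → (∁ Q ∩ N⁻ x) p ∧ twin p q) ≡ count (Q ∩ ∁ (N⁻ x))
      cols q q∈ = trans (count-cong swap) (twin-in-neighbours x∈Q q∉Q)
        where
        q∉Q : q ∉ Q
        q∉Q = not-injective (P∩Q⊆P (∁ Q) (N⁻ y) q q∈)
        swap : ∀ p → (∁ Q ∩ N⁻ x) p ∧ twin p q ≡ (∁ Q ∩ N⁻ x) p ∧ twin q p
        swap p with Q p in Qp
        ... | true  = refl
        ... | false = cong (arc p x ∧_) (twin-comm Qp q∉Q)

  module _ {x y : Fin n} (x≢y : x ≢ y) where

    pair : Pred n
    pair = ⁅ x ⁆ ∪ ⁅ y ⁆

    x∈pair : x ∈ pair
    x∈pair = ∨-introˡ (⁅ y ⁆ x) (x∈⁅x⁆ x)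

    y∈pair : y ∈ pair
    y∈pair = ∨-introʳ (⁅ x ⁆ y) (x∈⁅x⁆ y)

    |pair| : count pair ≡ 2
    |pair| = trans (count-∪-⁅⁆ {A = ⁅ x ⁆} (x≢y⇒x∉⁅y⁆ (x≢y ∘ sym))) (cong suc (count-⁅⁆ x))

    pair-filling : Σ[ Q ∈ Pred n ] pair ⊆ Q × Q ⊆ pair ∪ C⁻ pair × count Q ≡ l
    pair-filling = extend (λ v → ∨-introˡ (C⁻ pair v)) (subst (_≤ l) (sym |pair|) (s≤s (s≤s z≤n)))
      (≤-trans (In.l≤count-common (subst (_≤ 3 + k) (sym |pair|) (s≤s (s≤s z≤n))))
               (count-mono (λ v → ∨-introʳ (pair v))))

    module Pair {Q : Pred n} (pair⊆Q : pair ⊆ Q) (Q⊆ : Q ⊆ pair ∪ C⁻ pair) (|Q| : count Q ≡ l) where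

      Q∖N⁻z : ∀ {z} → z ∈ pair → count (Q ∩ ∁ (N⁻ z)) ≡ χ (not (arc x z)) + χ (not (arc y z))
      Q∖N⁻z {z} z∈pair =
        trans (count-cong (⊆-antisym {P = Q ∩ ∁ (N⁻ z)} forth back)) (count-⁅⁆∪⁅⁆-∩ x≢y (∁ (N⁻ z)))
        where
        forth : Q ∩ ∁ (N⁻ z) ⊆ pair ∩ ∁ (N⁻ z)
        forth v v∈ with ∨-elim (pair v) (Q⊆ v (P∩Q⊆P Q (∁ (N⁻ z)) v v∈))
        ... | inj₁ v∈pair   = ∧-intro v∈pair (P∩Q⊆Q Q (∁ (N⁻ z)) v v∈)
        ... | inj₂ v∈C⁻pair = contradiction (not-injective (P∩Q⊆Q Q (∁ (N⁻ z)) v v∈))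
                                            (not-¬ (In.∈-common⁻ v∈C⁻pair z z∈pair))
        back : pair ∩ ∁ (N⁻ z) ⊆ Q ∩ ∁ (N⁻ z)
        back v v∈ = ∧-intro (pair⊆Q v (P∩Q⊆P pair (∁ (N⁻ z)) v v∈)) (P∩Q⊆Q pair (∁ (N⁻ z)) v v∈)

      Q∖N⁻x : count (Q ∩ ∁ (N⁻ x)) ≡ suc (χ (not (arc y x)))
      Q∖N⁻x = trans (Q∖N⁻z x∈pair) (cong (λ b → χ (not b) + χ (not (arc y x))) (loopless x))

      Q∖N⁻y : count (Q ∩ ∁ (N⁻ y)) ≡ suc (χ (not (arc x y)))
      Q∖N⁻y = trans (Q∖N⁻z y∈pair) (trans (cong (λ b → χ (not (arc x y)) + χ (not b)) (loopless y)) (+-comm _ 1))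

      a b : ℕ
      a = count (∁ Q ∩ N⁻ x)
      b = count (∁ Q ∩ N⁻ y)

      balance : a * suc (χ (not (arc x y))) ≡ b * suc (χ (not (arc y x)))
      balance = subst₂ (λ c d → a * c ≡ b * d) Q∖N⁻y Q∖N⁻x
                       (Twins.in-balance |Q| (pair⊆Q x x∈pair) (pair⊆Q y y∈pair))

      split-x : indegree x + suc (χ (not (arc y x))) ≡ l + a
      split-x = subst₂ (λ c d → indegree x + c ≡ d + a) Q∖N⁻x |Q| (indegree-split Q x)

      split-y : indegree y + suc (χ (not (arc x y))) ≡ l + b
      split-y = subst₂ (λ c d → indegree y + c ≡ d + b) Q∖N⁻y |Q| (indegree-split Q y)

      l<a : l < a
      l<a = <-≤-trans (In.l<count-common (s≤s z≤n) |Q|) (count-mono C⁻Q⊆)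
        where
        C⁻Q⊆ : C⁻ Q ⊆ ∁ Q ∩ N⁻ x
        C⁻Q⊆ v v∈ = ∧-intro (cong not (In.common-disjoint v∈)) (In.∈-common⁻ v∈ x (pair⊆Q x x∈pair))

  indegree-≡ : ∀ x y → x ≢ y → arc x y ≡ arc y x → indegree x ≡ indegree y
  indegree-≡ x y x≢y xy≡yx with pair-filling x≢y
  ... | Q , pair⊆Q , Q⊆ , |Q| = equal-balance {a} {b} {m = l} balance′ split-x split-y′
    where
    open Pair x≢y pair⊆Q Q⊆ |Q|
    balance′ : a * suc (χ (not (arc y x))) ≡ b * suc (χ (not (arc y x)))
    balance′ = subst (λ t → a * suc (χ (not t)) ≡ b * suc (χ (not (arc y x)))) xy≡yx balance
    split-y′ : indegree y + suc (χ (not (arc y x))) ≡ l + b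
    split-y′ = subst (λ t → indegree y + suc (χ (not t)) ≡ l + b) xy≡yx split-y

  one-way-arc⇒≢ : ∀ {x y} → arc y x ≡ true → arc x y ≡ false → x ≢ y
  one-way-arc⇒≢ yx xy refl = not-¬ yx xy

  indegree-< : ∀ x y → arc y x ≡ true → arc x y ≡ false → indegree x < indegree y
  indegree-< x y yx xy with pair-filling (one-way-arc⇒≢ yx xy)
  ... | Q , pair⊆Q , Q⊆ , |Q| = one-way-balance {a} {b} {m = l} balance′ split-x′ split-y′ 1<a
    where
    open Pair (one-way-arc⇒≢ yx xy) pair⊆Q Q⊆ |Q|
    1<a : 1 < a
    1<a = ≤-<-trans (s≤s z≤n) l<a
    balance′ : a * 2 ≡ b * 1
    balance′ = subst₂ (λ s t → a * suc (χ (not s)) ≡ b * suc (χ (not t))) xy yx balance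
    split-x′ : indegree x + 1 ≡ l + a
    split-x′ = subst (λ t → indegree x + suc (χ (not t)) ≡ l + a) yx split-x
    split-y′ : indegree y + 2 ≡ l + b
    split-y′ = subst (λ s → indegree y + suc (χ (not s)) ≡ l + b) xy split-y

  symmetric : ∀ x y → arc x y ≡ arc y x
  symmetric = one-way-arcs-descend⇒symmetric arc loopless indegree-≡ indegree-<

  regular : ∀ x y → indegree x ≡ indegree y
  regular x y with x ≟ y
  ... | yes refl = refl
  ... | no  x≢y  = indegree-≡ x y x≢y (symmetric x y)

  l<indegree : ∀ x → l < indegree x
  l<indegree x with extend {B = ∁ ∅} (λ _ _ → refl) (subst (_≤ l) (sym (count-⁅⁆ x)) (s≤s z≤n))
                                      (subst (l ≤_) (sym count-∁∅) (<⇒≤ l<n))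
  ... | Q , ⁅x⁆⊆Q , _ , |Q| = <-≤-trans (In.l<count-common (s≤s z≤n) |Q|) (count-mono C⁻Q⊆N⁻x)
    where
    C⁻Q⊆N⁻x : C⁻ Q ⊆ N⁻ x
    C⁻Q⊆N⁻x v v∈ = In.∈-common⁻ v∈ x (⁅x⁆⊆Q x (x∈⁅x⁆ x))

  count-C⁺-balance : ∀ {Q} → count Q ≡ l → ∀ w → count (∁ Q) * l ≡ count (C⁺ Q) * (indegree w ∸ l)
  count-C⁺-balance {Q} |Q| w = double-count arc rows cols
    where
    rows : ∀ v → v ∈ ∁ Q → count (λ u → C⁺ Q u ∧ arc v u) ≡ l
    rows v v∉Q = Out.count-common-∩-N |Q| (not-injective v∉Q)
    cols : ∀ u → u ∈ C⁺ Q → count (λ v → not (Q v) ∧ arc v u) ≡ indegree w ∸ l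
    cols u u∈ = begin
      count (∁ Q ∩ N⁻ u)    ≡⟨ count-∩-comm (∁ Q) (N⁻ u) ⟩
      count (N⁻ u ∩ ∁ Q)    ≡⟨ count-─ (λ s s∈Q → Out.∈-common⁻ u∈ s s∈Q) ⟩
      indegree u ∸ count Q  ≡⟨ cong₂ _∸_ (regular u w) |Q| ⟩
      indegree w ∸ l        ∎
      where open ≡-Reasoning

  count-C⁺-constant : ∀ {Q Q′} → count Q ≡ l → count Q′ ≡ l → count (C⁺ Q) ≡ count (C⁺ Q′)
  count-C⁺-constant {Q} {Q′} |Q| |Q′| = *-cancelʳ-≡ _ _ (indegree w ∸ l) {{d∸l≢0}} (begin
    count (C⁺ Q) * (indegree w ∸ l)   ≡⟨ count-C⁺-balance |Q| w ⟨
    count (∁ Q) * l                   ≡⟨ cong (_* l) |∁Q|≡|∁Q′| ⟩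
    count (∁ Q′) * l                  ≡⟨ count-C⁺-balance |Q′| w ⟩
    count (C⁺ Q′) * (indegree w ∸ l)  ∎)
    where
    open ≡-Reasoning
    w : Fin n
    w = proj₁ (1≤count⇒∃ Q (subst (1 ≤_) (sym |Q|) (s≤s z≤n)))
    d∸l≢0 : NonZero (indegree w ∸ l)
    d∸l≢0 = >-nonZero (m<n⇒0<n∸m (l<indegree w))
    |∁Q|≡|∁Q′| : count (∁ Q) ≡ count (∁ Q′)
    |∁Q|≡|∁Q′| = trans (count-∁-∸ Q) (trans (cong (n ∸_) (trans |Q| (sym |Q′|))) (sym (count-∁-∸ Q′)))

  module Missing {P : Pred n} (|P| : count P ≡ suc k) {q : Fin n} (q∉P : q ∉ P) where

    Q : Pred n
    Q = P ∪ ⁅ q ⁆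

    |Q| : count Q ≡ l
    |Q| = trans (count-∪-⁅⁆ {A = P} q∉P) (cong suc |P|)

    |C⁺P∩Q| : count (C⁺ P ∩ Q) ≡ χ (C⁺ P q)
    |C⁺P∩Q| = trans (count-cong (⊆-antisym {P = C⁺ P ∩ Q} forth back)) (count-⁅⁆-∩ q (C⁺ P))
      where
      forth : C⁺ P ∩ Q ⊆ ⁅ q ⁆ ∩ C⁺ P
      forth v v∈ with ∨-elim (P v) (P∩Q⊆Q (C⁺ P) Q v v∈)
      ... | inj₁ v∈P = contradiction (Out.common-disjoint (P∩Q⊆P (C⁺ P) Q v v∈)) (not-¬ v∈P)
      ... | inj₂ v≡q = ∧-intro v≡q (P∩Q⊆P (C⁺ P) Q v v∈)
      back : ⁅ q ⁆ ∩ C⁺ P ⊆ C⁺ P ∩ Q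
      back v v∈ = ∧-intro (P∩Q⊆Q ⁅ q ⁆ (C⁺ P) v v∈) (∨-introʳ (P v) (P∩Q⊆P ⁅ q ⁆ (C⁺ P) v v∈))

    |C⁺P∖Q| : count (C⁺ P ∩ ∁ Q) ≡ count (C⁺ P) ∸ χ (C⁺ P q)
    |C⁺P∖Q| = begin
      count (C⁺ P ∩ ∁ Q)                                        ≡⟨ m+n∸m≡n (count (C⁺ P ∩ Q)) _ ⟨
      count (C⁺ P ∩ Q) + count (C⁺ P ∩ ∁ Q) ∸ count (C⁺ P ∩ Q)  ≡⟨ cong₂ _∸_ (count-∩-∁ (C⁺ P) Q) (sym |C⁺P∩Q|) ⟨
      count (C⁺ P) ∸ χ (C⁺ P q)                                 ∎
      where open ≡-Reasoning

    C⁺P∖Q-in-neighbours : ∀ {u} → u ∈ C⁺ Q →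
                          count (λ v → (C⁺ P ∩ ∁ Q) v ∧ arc v u) ≡ count (C⁺ Q) ∸ χ (C⁺ P q)
    C⁺P∖Q-in-neighbours {u} u∈C⁺Q = trans (sym (m+n∸m≡n (χ (C⁺ P q)) β)) (cong (_∸ χ (C⁺ P q)) (sym (begin
      count (C⁺ Q)                                             ≡⟨ count-C⁺-constant |Q| |P∪⁅u⁆| ⟩
      count (C⁺ (P ∪ ⁅ u ⁆))                                   ≡⟨ count-cong (Out.common-∪-⁅⁆ P u) ⟩
      count (C⁺ P ∩ N⁺ u)                                      ≡⟨ count-∩-∁ (C⁺ P ∩ N⁺ u) Q ⟩
      count ((C⁺ P ∩ N⁺ u) ∩ Q) + count ((C⁺ P ∩ N⁺ u) ∩ ∁ Q)  ≡⟨ cong₂ _+_ (count-cong in-Q) (count-cong out-Q) ⟩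
      count (C⁺ P ∩ Q) + β                                     ≡⟨ cong (_+ β) |C⁺P∩Q| ⟩
      χ (C⁺ P q) + β                                           ∎)))
      where
      open ≡-Reasoning
      β : ℕ
      β = count (λ v → (C⁺ P ∩ ∁ Q) v ∧ arc v u)
      u∉P : u ∉ P
      u∉P = ¬-not λ u∈P → not-¬ (∨-introˡ (⁅ q ⁆ u) u∈P) (Out.common-disjoint u∈C⁺Q)
      |P∪⁅u⁆| : count (P ∪ ⁅ u ⁆) ≡ l
      |P∪⁅u⁆| = trans (count-∪-⁅⁆ {A = P} u∉P) (cong suc |P|)
      Q⊆N⁺u : Q ⊆ N⁺ u
      Q⊆N⁺u v v∈Q = trans (symmetric u v) (Out.∈-common⁻ u∈C⁺Q v v∈Q)
      in-Q : (C⁺ P ∩ N⁺ u) ∩ Q ≗ C⁺ P ∩ Q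
      in-Q = ⊆-antisym {P = (C⁺ P ∩ N⁺ u) ∩ Q} forth back
        where
        forth : (C⁺ P ∩ N⁺ u) ∩ Q ⊆ C⁺ P ∩ Q
        forth v v∈ = ∧-intro (P∩Q⊆P (C⁺ P) (N⁺ u) v (P∩Q⊆P (C⁺ P ∩ N⁺ u) Q v v∈)) (P∩Q⊆Q (C⁺ P ∩ N⁺ u) Q v v∈)
        back : C⁺ P ∩ Q ⊆ (C⁺ P ∩ N⁺ u) ∩ Q
        back v v∈ = let v∈Q = P∩Q⊆Q (C⁺ P) Q v v∈ in ∧-intro (∧-intro (P∩Q⊆P (C⁺ P) Q v v∈) (Q⊆N⁺u v v∈Q)) v∈Q
      out-Q : ∀ v → (C⁺ P v ∧ arc u v) ∧ not (Q v) ≡ (C⁺ P v ∧ not (Q v)) ∧ arc v u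
      out-Q v = trans (cong (λ b → (C⁺ P v ∧ b) ∧ not (Q v)) (symmetric u v))
                      (∧-Props.xy∙z≈xz∙y (C⁺ P v) (arc v u) (not (Q v)))

    count-C⁺-identity : (count (C⁺ P) ∸ χ (C⁺ P q)) * l ≡ count (C⁺ Q) * (count (C⁺ Q) ∸ χ (C⁺ P q))
    count-C⁺-identity = subst (λ c → c * l ≡ count (C⁺ Q) * (count (C⁺ Q) ∸ χ (C⁺ P q))) |C⁺P∖Q|
                              (double-count arc rows (λ _ → C⁺P∖Q-in-neighbours))
      where
      rows : ∀ v → v ∈ C⁺ P ∩ ∁ Q → count (λ u → C⁺ Q u ∧ arc v u) ≡ l
      rows v v∈ = Out.count-common-∩-N |Q| (not-injective (P∩Q⊆Q (C⁺ P) (∁ Q) v v∈))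

  separating-set : ∀ {x y} → x ≢ y → Σ[ P ∈ Pred n ] y ∈ P × x ∉ P × count P ≡ suc k
  separating-set {x} {y} x≢y =
    let P , ⁅y⁆⊆P , P⊆∁⁅x⁆ , |P| = extend ⁅y⁆⊆∁⁅x⁆ (subst (_≤ suc k) (sym (count-⁅⁆ y)) (s≤s z≤n)) room
    in  P , ⁅y⁆⊆P y (x∈⁅x⁆ y) , ¬-not (λ x∈P → not-¬ (x∈⁅x⁆ x) (not-injective (P⊆∁⁅x⁆ x x∈P))) , |P|
    where
    ⁅y⁆⊆∁⁅x⁆ : ⁅ y ⁆ ⊆ ∁ ⁅ x ⁆
    ⁅y⁆⊆∁⁅x⁆ v v∈ = cong not (x≢y⇒x∉⁅y⁆ {x = v} (λ v≡x → x≢y (trans (sym v≡x) (x∈⁅y⁆⇒x≡y v∈))))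
    room : suc k ≤ count (∁ ⁅ x ⁆)
    room = subst (suc k ≤_) (sym (trans (count-∁-∸ ⁅ x ⁆) (cong (n ∸_) (count-⁅⁆ x))))
                 (≤-trans (n≤1+n (suc k)) (∸-monoˡ-≤ 1 l<n))

  no-non-adjacent-pair : ∀ {x y} → x ≢ y → arc x y ≡ false → ⊥
  no-non-adjacent-pair {x} {y} x≢y xy with separating-set x≢y
  ... | P , y∈P , x∉P , |P| = <-irrefl (sym m≡l) l<m
    where
    x∉C⁺P : x ∉ C⁺ P
    x∉C⁺P = ¬-not λ x∈C⁺P → not-¬ (Out.∈-common⁻ x∈C⁺P y y∈P) (trans (symmetric y x) xy)
    0<|C⁺P| : 0 < count (C⁺ P)
    0<|C⁺P| = ≤-trans (s≤s z≤n) (Out.l≤count-common (subst (_≤ 3 + k) (sym |P|) (m≤n+m (suc k) 2)))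
    q∈C⁺P : ∃[ q ] q ∈ C⁺ P
    q∈C⁺P = 1≤count⇒∃ (C⁺ P) 0<|C⁺P|
    module Mx = Missing |P| x∉P
    module Mq = Missing |P| (Out.common-disjoint (proj₂ q∈C⁺P))
    m : ℕ
    m = count (C⁺ Mx.Q)
    l<m : l < m
    l<m = Out.l<count-common (s≤s z≤n) Mx.|Q|
    identity-x : count (C⁺ P) * l ≡ m * m
    identity-x = subst (λ b → (count (C⁺ P) ∸ χ b) * l ≡ m * (m ∸ χ b)) x∉C⁺P Mx.count-C⁺-identity
    identity-q : (count (C⁺ P) ∸ 1) * l ≡ m * (m ∸ 1)
    identity-q = subst₂ (λ b m′ → (count (C⁺ P) ∸ χ b) * l ≡ m′ * (m′ ∸ χ b))
                        (proj₂ q∈C⁺P) (count-C⁺-constant Mq.|Q| Mx.|Q|) Mq.count-C⁺-identity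
    m≡l : m ≡ l
    m≡l = shifted-identities⇒≡ 0<|C⁺P| (≤-trans (s≤s z≤n) (<⇒≤ l<m)) identity-x identity-q

  complete : ∀ x y → x ≢ y → arc x y ≡ true
  complete x y x≢y = ¬-not (no-non-adjacent-pair x≢y)

  n≡2l+1 : n ≡ 2 * l + 1
  n≡2l+1 with choose (∁ ∅) (subst (suc l ≤_) (sym count-∁∅) l<n)
  ... | S , _ , |S| = begin
    n                      ≡⟨ count-∁ S ⟨
    count S + count (∁ S)  ≡⟨ cong₂ _+_ |S| |∁S| ⟩
    suc (l + l)            ≡⟨ cong (λ t → suc (l + t)) (+-identityʳ l) ⟨
    suc (2 * l)            ≡⟨ +-comm 1 (2 * l) ⟩
    2 * l + 1              ∎
    where
    open ≡-Reasoning
    C⁺S≗∁S : C⁺ S ≗ ∁ S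
    C⁺S≗∁S = ⊆-antisym {P = C⁺ S}
      (λ v v∈ → cong not (Out.common-disjoint v∈))
      (λ v v∉S → Out.∈-common⁺ λ s s∈S → complete s v λ { refl → not-¬ s∈S (not-injective v∉S) })
    |∁S| : count (∁ S) ≡ l
    |∁S| = trans (count-cong (sym ∘ C⁺S≗∁S)) (out-liking S |S|)

liking⇒count-common : ∀ {n l} (r : Fin n → Fin n → Bool) (common : Subset n → Subset n) →
  (∀ A → common (tabulate A) ≡ tabulate (Neighbourhood.common r A)) →
  (∀ S → ∣ S ∣ ≡ l + 1 → ∣ common S ∣ ≡ l) →
  ∀ A → count A ≡ suc l → count (Neighbourhood.common r A) ≡ l
liking⇒count-common {l = l} r common common≡ liking A |A| = begin
  count (Neighbourhood.common r A)          ≡⟨ ∣tabulate∣≡count _ ⟨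
  ∣ tabulate (Neighbourhood.common r A) ∣   ≡⟨ cong ∣_∣ (common≡ A) ⟨
  ∣ common (tabulate A) ∣                   ≡⟨ liking (tabulate A) |tabulate-A| ⟩
  l                                         ∎
  where
  open ≡-Reasoning
  |tabulate-A| : ∣ tabulate A ∣ ≡ l + 1
  |tabulate-A| = trans (∣tabulate∣≡count A) (trans |A| (+-comm 1 l))

module _ (D : Digraph) where

  commonOut-tabulate : ∀ A → commonOut D (tabulate A) ≡ tabulate (Neighbourhood.common (arc D) A)
  commonOut-tabulate A = tabulate-cong λ v →
    cong and (map-cong (λ s → cong (λ b → not b ∨ arc D s v) (lookup∘tabulate A s)) (allFin (order D)))

  commonIn-tabulate : ∀ A → commonIn D (tabulate A) ≡ tabulate (Neighbourhood.common (flip (arc D)) A)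
  commonIn-tabulate A = tabulate-cong λ v →
    cong and (map-cong (λ s → cong (λ b → not b ∨ arc D v s) (lookup∘tabulate A s)) (allFin (order D)))

  out-liking : ∀ {l} → TwoWayLiking (l + 1) l D →
               ∀ A → count A ≡ suc l → count (Neighbourhood.common (arc D) A) ≡ l
  out-liking liking = liking⇒count-common (arc D) (commonOut D) commonOut-tabulate (λ S → proj₁ ∘ liking S)

  in-liking : ∀ {l} → TwoWayLiking (l + 1) l D →
              ∀ A → count A ≡ suc l → count (Neighbourhood.common (flip (arc D)) A) ≡ l
  in-liking liking = liking⇒count-common (flip (arc D)) (commonIn D) commonIn-tabulate (λ S → proj₂ ∘ liking S)

  ≅-completeDigraph : ∀ {m} → order D ≡ m → (∀ x y → arc D x y ≡ not ⌊ x ≟ y ⌋) → D ≅ completeDigraph m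
  ≅-completeDigraph refl arc≡ = ⤖-id _ , arc≡

proposition3p5 : (l : ℕ) → 2 ≤ l → (D : Digraph) → l + 1 ≤ order D →
    TwoWayLiking (l + 1) l D → D ≅ completeDigraph (2 * l + 1)
proposition3p5 (suc (suc k)) (s≤s (s≤s z≤n)) D l+1≤n liking = ≅-completeDigraph D n≡2l+1 arc≡
  where
  open TwoWayLikingDigraph (arc D) (loopless D) k (subst (_≤ order D) (+-comm (2 + k) 1) l+1≤n)
                           (out-liking D liking) (in-liking D liking)
  arc≡ : ∀ x y → arc D x y ≡ not ⌊ x ≟ y ⌋
  arc≡ x y with x ≟ y
  ... | yes refl = loopless D x
  ... | no  x≢y  = complete x y x≢y
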